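{- If $G$ is a simple bipartite graph with bipartition $(X, Y)$ such that no vertex in $X$ is adjacent to every vertex in $Y$, then $$\sum\left(\frac{|X|d(x) - |Y|d(y)}{(|X| - d(y))(|Y| - d(x))} : x \in X,~y\in Y,~xy\notin E(G)\right) \geq 0.$$
   Context: $d(v)$ denotes the degree of vertex $v$ in $G$; the sum is over all pairs $(x,y)$ with $x\in X$, $y\in Y$ and $x,y$ non-adjacent. -}

module Defs where

open import Data.Bool using (Bool; true; false; if_then_else_; not)
open import Data.Nat as ℕ using (ℕ; zero; suc)
open import Data.Fin using (Fin; zero; suc)
open import Data.Integer as ℤ using (ℤ; +_)
open import Data.Rational as ℚ using (ℚ; 0ℚ)

sumℕ : ∀ {k} → (Fin k → ℕ) → ℕ
sumℕ {zero}  f = 0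
sumℕ {suc k} f = f zero ℕ.+ sumℕ (λ i → f (suc i))

sumℚ : ∀ {k} → (Fin k → ℚ) → ℚ
sumℚ {zero}  f = 0ℚ
sumℚ {suc k} f = f zero ℚ.+ sumℚ (λ i → f (suc i))

-- A simple bipartite graph with bipartition (X, Y), X = Fin m, Y = Fin n,
-- given by its biadjacency relation: adj x y = true iff xy ∈ E(G).
BipGraph : ℕ → ℕ → Set
BipGraph m n = Fin m → Fin n → Bool

b2n : Bool → ℕ
b2n true  = 1
b2n false = 0

degX : ∀ {m n} → BipGraph m n → Fin m → ℕ
degX G x = sumℕ (λ y → b2n (G x y))

degY : ∀ {m n} → BipGraph m n → Fin n → ℕ
degY G y = sumℕ (λ x → b2n (G x y))

-- integer / natural as a rational; only used with positive denominators
-- (for nonadjacent pairs the denominator is always positive); 0 if d = 0.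
divℚ : ℤ → ℕ → ℚ
divℚ z zero    = 0ℚ
divℚ z (suc d) = z ℚ./ suc d

term : ∀ {m n} → BipGraph m n → Fin m → Fin n → ℚ
term {m} {n} G x y =
  divℚ (+ (m ℕ.* degX G x) ℤ.- + (n ℕ.* degY G y))
       ((m ℕ.∸ degY G y) ℕ.* (n ℕ.∸ degX G x))

theSum : ∀ {m n} → BipGraph m n → ℚ
theSum G = sumℚ (λ x → sumℚ (λ y → if G x y then 0ℚ else term G x y))

-- For a non-edge xy both d(x) < |Y| and d(y) < |X|, and the summand splits as
-- d(x)/(|Y| - d(x)) - d(y)/(|X| - d(y)).  Summing the first part over the |Y| - d(x)
-- non-neighbours of each x gives exactly Σ d(x) = |E|, because every x has a
-- non-neighbour; summing the second part over the |X| - d(y) non-neighbours of each y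
-- gives at most Σ d(y) = |E|, with a deficit exactly at the y adjacent to all of X.
-- The sums over y are the sums over x of the transposed graph flip G.

module Submission where

open import Algebra.Bundles using (CommutativeRing)
open import Data.Bool using (Bool; true; false; not; if_then_else_)
open import Data.Fin using (Fin; zero; suc)
open import Data.Integer as ℤ using (ℤ; +_; +0; +[1+_]; -[1+_])
import Data.Integer.Properties as ℤP
import Data.Integer.Tactic.RingSolver as ℤ-Ring
open import Data.Maybe using (nothing)
open import Data.Nat as ℕ using (ℕ; zero; suc; _∸_; s≤s; z≤n)
import Data.Nat.Properties as ℕP
open import Data.Product using (∃; _,_)
open import Data.Rational as ℚ using (ℚ; 0ℚ; _+_; _*_; _-_; -_; _/_; _≤_; toℚᵘ; Positive)
open import Data.Rational.Literals using (fromℤ)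
open import Data.Rational.Properties
open import Data.Rational.Unnormalised as ℚᵘ using (*≡*; mkℚᵘ)
import Data.Rational.Unnormalised.Properties as ℚᵘP
open import Function using (_∘_; flip)
open import Relation.Binary.PropositionalEquality
import Tactic.RingSolver.Core.AlmostCommutativeRing as ACR
open import Tactic.RingSolver using (solve-∀)

open import Defs

open import Algebra.Properties.Semiring.Sum (CommutativeRing.semiring +-*-commutativeRing)
  using (sum; sum-syntax; sum-cong-≗; ∑-distrib-+; ∑-comm; *-distribʳ-sum)

ℚ-ring : ACR.AlmostCommutativeRing _ _
ℚ-ring = ACR.fromCommutativeRing +-*-commutativeRing (λ _ → nothing)

fromℕ : ℕ → ℚ
fromℕ n = fromℤ (+ n)

-- Sums and products of integer-valued rationals compute to _/ 1, which ↥p/↧p≡p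
-- identifies with fromℤ.
fromℤ-+ : ∀ x y → fromℤ (x ℤ.+ y) ≡ fromℤ x + fromℤ y
fromℤ-+ x y = trans (cong fromℤ (cong₂ ℤ._+_ (sym (ℤP.*-identityʳ x)) (sym (ℤP.*-identityʳ y))))
                    (sym (↥p/↧p≡p (fromℤ (x ℤ.* + 1 ℤ.+ y ℤ.* + 1))))

fromℤ-* : ∀ x y → fromℤ (x ℤ.* y) ≡ fromℤ x * fromℤ y
fromℤ-* x y = sym (↥p/↧p≡p (fromℤ (x ℤ.* y)))

fromℤ-neg : ∀ x → fromℤ (ℤ.- x) ≡ - fromℤ x
fromℤ-neg +0       = refl
fromℤ-neg +[1+ n ] = refl
fromℤ-neg -[1+ n ] = refl

fromℤ-- : ∀ x y → fromℤ (x ℤ.- y) ≡ fromℤ x - fromℤ y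
fromℤ-- x y = trans (fromℤ-+ x (ℤ.- y)) (cong (λ q → fromℤ x + q) (fromℤ-neg y))

fromℕ-+ : ∀ a b → fromℕ (a ℕ.+ b) ≡ fromℕ a + fromℕ b
fromℕ-+ a b = trans (cong fromℤ (ℤP.pos-+ a b)) (fromℤ-+ (+ a) (+ b))

fromℕ-* : ∀ a b → fromℕ (a ℕ.* b) ≡ fromℕ a * fromℕ b
fromℕ-* a b = trans (cong fromℤ (ℤP.pos-* a b)) (fromℤ-* (+ a) (+ b))

-- z / suc k is fromℚᵘ (mkℚᵘ z k) by definition.
n/d*d≡n : ∀ z k → z / suc k * fromℕ (suc k) ≡ fromℤ z
n/d*d≡n z k = toℚᵘ-injective (begin
  toℚᵘ (z / suc k * fromℕ (suc k))        ≈⟨ toℚᵘ-homo-* (z / suc k) (fromℕ (suc k)) ⟩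
  toℚᵘ (z / suc k) ℚᵘ.* mkℚᵘ (+ suc k) 0  ≈⟨ ℚᵘP.*-congʳ (toℚᵘ-fromℚᵘ (mkℚᵘ z k)) ⟩
  mkℚᵘ z k ℚᵘ.* mkℚᵘ (+ suc k) 0          ≈⟨ *≡* (trans (ℤP.*-identityʳ _)
                                                (cong (λ d → z ℤ.* + d) (sym (ℕP.*-identityʳ (suc k))))) ⟩
  mkℚᵘ z 0                                ∎)
  where open ℚᵘP.≃-Reasoning

*-cancelʳ-≡ : ∀ {p q} r .{{_ : Positive r}} → p * r ≡ q * r → p ≡ q
*-cancelʳ-≡ r eq =
  ≤-antisym (*-cancelʳ-≤-pos r (≤-reflexive eq)) (*-cancelʳ-≤-pos r (≤-reflexive (sym eq)))

a/q-b/s≡[a*s-b*q]/[q*s] : ∀ a b q s →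
  a / suc q - b / suc s ≡ (a ℤ.* + suc s ℤ.- b ℤ.* + suc q) / (suc q ℕ.* suc s)
a/q-b/s≡[a*s-b*q]/[q*s] a b q s = *-cancelʳ-≡ (fromℕ (suc q ℕ.* suc s)) (begin
  (u - v) * fromℕ (suc q ℕ.* suc s)
    ≡⟨ cong (_*_ (u - v)) (fromℕ-* (suc q) (suc s)) ⟩
  (u - v) * (Q * S)
    ≡⟨ distribute u v Q S ⟩
  u * Q * S - v * S * Q
    ≡⟨ cong₂ (λ x y → x * S - y * Q) (n/d*d≡n a q) (n/d*d≡n b s) ⟩
  fromℤ a * S - fromℤ b * Q
    ≡⟨ cong₂ _-_ (fromℤ-* a (+ suc s)) (fromℤ-* b (+ suc q)) ⟨
  fromℤ (a ℤ.* + suc s) - fromℤ (b ℤ.* + suc q)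
    ≡⟨ fromℤ-- (a ℤ.* + suc s) (b ℤ.* + suc q) ⟨
  fromℤ (a ℤ.* + suc s ℤ.- b ℤ.* + suc q)
    ≡⟨ n/d*d≡n _ _ ⟨
  (a ℤ.* + suc s ℤ.- b ℤ.* + suc q) / (suc q ℕ.* suc s) * fromℕ (suc q ℕ.* suc s) ∎)
  where
  open ≡-Reasoning
  u = a / suc q
  v = b / suc s
  Q = fromℕ (suc q)
  S = fromℕ (suc s)
  distribute : ∀ u v Q S → (u - v) * (Q * S) ≡ u * Q * S - v * S * Q
  distribute = solve-∀ ℚ-ring

divℚ-difference : ∀ {m n a b k l} → k ℕ.+ a ≡ n → l ℕ.+ b ≡ m → 0 ℕ.< k → 0 ℕ.< l →
  divℚ (+ (m ℕ.* a) ℤ.- + (n ℕ.* b)) ((m ∸ b) ℕ.* (n ∸ a)) ≡ divℚ (+ a) k - divℚ (+ b) l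
divℚ-difference {a = a} {b} {suc k} {suc l} refl refl (s≤s z≤n) (s≤s z≤n) = begin
  divℚ (+ ((suc l ℕ.+ b) ℕ.* a) ℤ.- + ((suc k ℕ.+ a) ℕ.* b)) ((suc l ℕ.+ b ∸ b) ℕ.* (suc k ℕ.+ a ∸ a))
    ≡⟨ cong₂ divℚ numerator denominator ⟩
  divℚ (+ a ℤ.* + suc l ℤ.- + b ℤ.* + suc k) (suc k ℕ.* suc l)
    ≡⟨ a/q-b/s≡[a*s-b*q]/[q*s] (+ a) (+ b) k l ⟨
  divℚ (+ a) (suc k) - divℚ (+ b) (suc l) ∎
  where
  open ≡-Reasoning
  pos-+-* : ∀ p q r → + ((p ℕ.+ q) ℕ.* r) ≡ (+ p ℤ.+ + q) ℤ.* + r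
  pos-+-* p q r = trans (ℤP.pos-* (p ℕ.+ q) r) (cong (ℤ._* + r) (ℤP.pos-+ p q))
  cancel-cross-terms : ∀ A B K L → (L ℤ.+ B) ℤ.* A ℤ.- (K ℤ.+ A) ℤ.* B ≡ A ℤ.* L ℤ.- B ℤ.* K
  cancel-cross-terms = ℤ-Ring.solve-∀
  numerator : + ((suc l ℕ.+ b) ℕ.* a) ℤ.- + ((suc k ℕ.+ a) ℕ.* b) ≡ + a ℤ.* + suc l ℤ.- + b ℤ.* + suc k
  numerator = trans (cong₂ ℤ._-_ (pos-+-* (suc l) b a) (pos-+-* (suc k) a b))
                    (cancel-cross-terms (+ a) (+ b) (+ suc k) (+ suc l))
  denominator : (suc l ℕ.+ b ∸ b) ℕ.* (suc k ℕ.+ a ∸ a) ≡ suc k ℕ.* suc l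
  denominator = trans (cong₂ ℕ._*_ (ℕP.m+n∸n≡m (suc l) b) (ℕP.m+n∸n≡m (suc k) a))
                      (ℕP.*-comm (suc l) (suc k))

k*divℚ[z,k]≡z : ∀ z {k} → 0 ℕ.< k → fromℕ k * divℚ z k ≡ fromℤ z
k*divℚ[z,k]≡z z {suc k} _ = trans (*-comm (fromℕ (suc k)) (z / suc k)) (n/d*d≡n z k)

-- Only an inequality because divℚ a 0 = 0.
k*divℚ[a,k]≤a : ∀ a k → fromℕ k * divℚ (+ a) k ≤ fromℕ a
k*divℚ[a,k]≤a a zero    = nonNegative⁻¹ (fromℕ a)
k*divℚ[a,k]≤a a (suc k) = ≤-reflexive (k*divℚ[z,k]≡z (+ a) (s≤s z≤n))

#true : ∀ {k} → (Fin k → Bool) → ℕ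
#true f = sumℕ (λ i → b2n (f i))

#false : ∀ {k} → (Fin k → Bool) → ℕ
#false f = sumℕ (λ i → b2n (not (f i)))

#false+#true≡size : ∀ {k} (f : Fin k → Bool) → #false f ℕ.+ #true f ≡ k
#false+#true≡size {zero}  f = refl
#false+#true≡size {suc k} f with f zero
... | true  = trans (ℕP.+-suc (#false (f ∘ suc)) (#true (f ∘ suc)))
                    (cong suc (#false+#true≡size (f ∘ suc)))
... | false = cong suc (#false+#true≡size (f ∘ suc))

#false-pos : ∀ {k} (f : Fin k → Bool) i → f i ≡ false → 0 ℕ.< #false f
#false-pos f zero    fi≡false rewrite fi≡false = s≤s z≤n
#false-pos f (suc i) fi≡false = ℕP.<-≤-trans (#false-pos (f ∘ suc) i fi≡false) (ℕP.m≤n+m _ _)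

ratio : ∀ {k} → (Fin k → Bool) → ℚ
ratio f = divℚ (+ #true f) (#false f)

#false*ratio≤#true : ∀ {k} (f : Fin k → Bool) → fromℕ (#false f) * ratio f ≤ fromℕ (#true f)
#false*ratio≤#true f = k*divℚ[a,k]≤a (#true f) (#false f)

#false*ratio≡#true : ∀ {k} (f : Fin k → Bool) i → f i ≡ false →
  fromℕ (#false f) * ratio f ≡ fromℕ (#true f)
#false*ratio≡#true f i fi≡false = k*divℚ[z,k]≡z (+ #true f) (#false-pos f i fi≡false)

term-nonadjacent : ∀ {m n} (G : BipGraph m n) x y → G x y ≡ false →
  term G x y ≡ ratio (G x) - ratio (flip G y)
term-nonadjacent G x y xy∉E =
  divℚ-difference (#false+#true≡size (G x)) (#false+#true≡size (flip G y))
                  (#false-pos (G x) y xy∉E) (#false-pos (flip G y) x xy∉E)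

sumℚ≡sum : ∀ {k} (f : Fin k → ℚ) → sumℚ f ≡ sum f
sumℚ≡sum {zero}  f = refl
sumℚ≡sum {suc k} f = cong (_+_ (f zero)) (sumℚ≡sum (f ∘ suc))

∑-neg : ∀ {k} (f : Fin k → ℚ) → ∑[ i < k ] (- f i) ≡ - sum f
∑-neg {zero}  f = refl
∑-neg {suc k} f = trans (cong (_+_ (- f zero)) (∑-neg (f ∘ suc))) (sym (neg-distrib-+ (f zero) _))

∑-distrib-- : ∀ {k} (f g : Fin k → ℚ) → ∑[ i < k ] (f i - g i) ≡ sum f - sum g
∑-distrib-- f g = trans (∑-distrib-+ f (-_ ∘ g)) (cong (_+_ (sum f)) (∑-neg g))

∑-mono-≤ : ∀ {k} {f g : Fin k → ℚ} → (∀ i → f i ≤ g i) → sum f ≤ sum g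
∑-mono-≤ {zero}  f≤g = ≤-refl
∑-mono-≤ {suc k} f≤g = +-mono-≤ (f≤g zero) (∑-mono-≤ (f≤g ∘ suc))

fromℕ-sumℕ : ∀ {k} (f : Fin k → ℕ) → fromℕ (sumℕ f) ≡ ∑[ i < k ] fromℕ (f i)
fromℕ-sumℕ {zero}  f = refl
fromℕ-sumℕ {suc k} f =
  trans (fromℕ-+ (f zero) _) (cong (_+_ (fromℕ (f zero))) (fromℕ-sumℕ (f ∘ suc)))

∑-if-then-0 : ∀ {k} (f : Fin k → Bool) q →
  ∑[ i < k ] (if f i then 0ℚ else q) ≡ fromℕ (#false f) * q
∑-if-then-0 {k} f q = begin
  ∑[ i < k ] (if f i then 0ℚ else q)          ≡⟨ sum-cong-≗ (λ i → if-then-0 (f i)) ⟩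
  ∑[ i < k ] (fromℕ (b2n (not (f i))) * q)    ≡⟨ *-distribʳ-sum q (λ i → fromℕ (b2n (not (f i)))) ⟨
  ∑[ i < k ] fromℕ (b2n (not (f i))) * q      ≡⟨ cong (_* q) (fromℕ-sumℕ (λ i → b2n (not (f i)))) ⟨
  fromℕ (#false f) * q                        ∎
  where
  open ≡-Reasoning
  if-then-0 : ∀ b → (if b then 0ℚ else q) ≡ fromℕ (b2n (not b)) * q
  if-then-0 true  = sym (*-zeroˡ q)
  if-then-0 false = sym (*-identityˡ q)

p≤q⇒0≤q-p : ∀ {p q} → p ≤ q → 0ℚ ≤ q - p
p≤q⇒0≤q-p {p} {q} p≤q = begin
  0ℚ     ≡⟨ +-inverseʳ p ⟨
  p - p  ≤⟨ +-monoˡ-≤ (- p) p≤q ⟩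
  q - p  ∎
  where open ≤-Reasoning

nonEdgeRatioSum : ∀ {m n} → BipGraph m n → ℚ
nonEdgeRatioSum {m} {n} G = ∑[ x < m ] ∑[ y < n ] (if G x y then 0ℚ else ratio (G x))

nonEdgeRatioSum≤∑degX : ∀ {m n} (G : BipGraph m n) →
  nonEdgeRatioSum G ≤ ∑[ x < m ] fromℕ (degX G x)
nonEdgeRatioSum≤∑degX G = ∑-mono-≤ λ x →
  ≤-trans (≤-reflexive (∑-if-then-0 (G x) (ratio (G x)))) (#false*ratio≤#true (G x))

nonEdgeRatioSum≡∑degX : ∀ {m n} (G : BipGraph m n) → ((x : Fin m) → ∃ λ y → G x y ≡ false) →
  nonEdgeRatioSum G ≡ ∑[ x < m ] fromℕ (degX G x)
nonEdgeRatioSum≡∑degX G nonneighbour = sum-cong-≗ λ x → let y , xy∉E = nonneighbour x in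
  trans (∑-if-then-0 (G x) (ratio (G x))) (#false*ratio≡#true (G x) y xy∉E)

∑degX≡∑degY : ∀ {m n} (G : BipGraph m n) →
  ∑[ x < m ] fromℕ (degX G x) ≡ ∑[ y < n ] fromℕ (degY G y)
∑degX≡∑degY {m} {n} G = begin
  ∑[ x < m ] fromℕ (degX G x)                   ≡⟨ sum-cong-≗ (λ x → fromℕ-sumℕ (λ y → b2n (G x y))) ⟩
  ∑[ x < m ] ∑[ y < n ] fromℕ (b2n (G x y))     ≡⟨ ∑-comm (λ x y → fromℕ (b2n (G x y))) ⟩
  ∑[ y < n ] ∑[ x < m ] fromℕ (b2n (G x y))     ≡⟨ sum-cong-≗ (λ y → fromℕ-sumℕ (λ x → b2n (G x y))) ⟨
  ∑[ y < n ] fromℕ (degY G y)                   ∎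
  where open ≡-Reasoning

theSum≡nonEdgeRatioSum-nonEdgeRatioSum[flip] : ∀ {m n} (G : BipGraph m n) →
  theSum G ≡ nonEdgeRatioSum G - nonEdgeRatioSum (flip G)
theSum≡nonEdgeRatioSum-nonEdgeRatioSum[flip] {m} {n} G = begin
  theSum G
    ≡⟨ sumℚ≡sum (λ x → sumℚ (summand x)) ⟩
  ∑[ x < m ] sumℚ (summand x)
    ≡⟨ sum-cong-≗ (λ x → sumℚ≡sum (summand x)) ⟩
  ∑[ x < m ] ∑[ y < n ] summand x y
    ≡⟨ sum-cong-≗ (λ x → sum-cong-≗ (summand-split x)) ⟩
  ∑[ x < m ] ∑[ y < n ] (ratioX x y - ratioY x y)
    ≡⟨ sum-cong-≗ (λ x → ∑-distrib-- (ratioX x) (ratioY x)) ⟩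
  ∑[ x < m ] (sum (ratioX x) - sum (ratioY x))
    ≡⟨ ∑-distrib-- (sum ∘ ratioX) (sum ∘ ratioY) ⟩
  nonEdgeRatioSum G - ∑[ x < m ] ∑[ y < n ] ratioY x y
    ≡⟨ cong (_-_ (nonEdgeRatioSum G)) (∑-comm ratioY) ⟩
  nonEdgeRatioSum G - nonEdgeRatioSum (flip G) ∎
  where
  open ≡-Reasoning
  summand ratioX ratioY : Fin m → Fin n → ℚ
  summand x y = if G x y then 0ℚ else term G x y
  ratioX  x y = if G x y then 0ℚ else ratio (G x)
  ratioY  x y = if G x y then 0ℚ else ratio (flip G y)
  summand-split : ∀ x y → summand x y ≡ ratioX x y - ratioY x y
  summand-split x y with G x y in Gxy≡b
  ... | true  = sym (+-inverseʳ 0ℚ)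
  ... | false = term-nonadjacent G x y Gxy≡b

proposition6p2 : (m n : ℕ) (G : BipGraph m n) →
    ((x : Fin m) → ∃ λ (y : Fin n) → G x y ≡ false) →
    0ℚ ≤ theSum G
proposition6p2 m n G nonneighbour = begin
  0ℚ                                            ≤⟨ p≤q⇒0≤q-p (begin
    nonEdgeRatioSum (flip G)                        ≤⟨ nonEdgeRatioSum≤∑degX (flip G) ⟩
    ∑[ y < n ] fromℕ (degY G y)                     ≡⟨ ∑degX≡∑degY G ⟨
    ∑[ x < m ] fromℕ (degX G x)                     ≡⟨ nonEdgeRatioSum≡∑degX G nonneighbour ⟨
    nonEdgeRatioSum G                               ∎) ⟩
  nonEdgeRatioSum G - nonEdgeRatioSum (flip G)  ≡⟨ theSum≡nonEdgeRatioSum-nonEdgeRatioSum[flip] G ⟨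
  theSum G                                      ∎
  where open ≤-Reasoning
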